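{- For every integer $k\geq 2$, there is a connected identifiable graph $G_k$ with $\gamma^{\mathrm{L}}(G_k)=2^k-1$ and $\gamma_t^{\mathrm{ID}}(G_k)=3\cdot 2^k-2k-3=3\gamma^{\mathrm{L}}(G_k)-2\log_2(\gamma^{\mathrm{L}}(G_k)+1)$.
   Context: All graphs are finite, simple and undirected. $N[v]$ is the closed neighbourhood of $v$; for $C\subseteq V(G)$, $I(v)=N[v]\cap C$. A locating-dominating set is a dominating set $C$ such that $I(u)\neq I(v)$ for all distinct $u,v\notin C$; $\gamma^{\mathrm{L}}(G)$ is its minimum size. A total dominating identifying code is a set $C$ with $I(u)\neq I(v)$ for all distinct vertices $u,v$ and such that every vertex has a neighbour in $C$; $\gamma_t^{\mathrm{ID}}(G)$ is its minimum size. A graph is identifiable if it has no distinct $u,v$ with $N[u]=N[v]$ and no isolated vertices. -}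

module Defs where

open import Data.Nat using (ℕ; _≤_)
open import Data.Bool using (Bool; true; false; T)
open import Data.Fin using (Fin)
open import Data.Fin.Subset using (Subset; _∈_; _∉_; _∩_; ∣_∣)
open import Data.Vec using (tabulate)
open import Data.Product using (Σ; _×_; ∃)
open import Relation.Binary.PropositionalEquality using (_≡_; _≢_)
open import Relation.Nullary using (¬_)

record Graph (n : ℕ) : Set where
  field
    adj   : Fin n → Fin n → Bool
    sym   : ∀ u v → adj u v ≡ adj v u
    irref : ∀ v → adj v v ≡ false

open Graph public

module _ {n : ℕ} (G : Graph n) where

  Adj : Fin n → Fin n → Set
  Adj u v = T (adj G u v)

  N[_] : Fin n → Subset n
  N[ v ] = tabulate λ u → Data.Bool._∨_ (adj G v u) (isEq u)
    where
      isEq : Fin n → Bool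
      isEq u = Relation.Nullary.Decidable.⌊ Data.Fin._≟_ v u ⌋
        where import Relation.Nullary.Decidable
              import Data.Fin

  I : Subset n → Fin n → Subset n
  I C v = N[ v ] ∩ C

  Dominating : Subset n → Set
  Dominating C = ∀ v → Σ (Fin n) λ c → c ∈ C × c ∈ N[ v ]

  LocatingDominating : Subset n → Set
  LocatingDominating C =
    Dominating C × (∀ u v → u ∉ C → v ∉ C → u ≢ v → I C u ≢ I C v)

  TotalDominating : Subset n → Set
  TotalDominating C = ∀ v → Σ (Fin n) λ c → c ∈ C × Adj v c

  TotalDominatingIdentifyingCode : Subset n → Set
  TotalDominatingIdentifyingCode C =
    TotalDominating C × (∀ u v → u ≢ v → I C u ≢ I C v)

  Identifiable : Set
  Identifiable = (∀ u v → u ≢ v → N[ u ] ≢ N[ v ])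
               × (∀ v → Σ (Fin n) λ u → Adj v u)

  data Walk : Fin n → Fin n → Set where
    here : ∀ {v} → Walk v v
    step : ∀ {u w v} → Adj u w → Walk w v → Walk u v

  Connected : Set
  Connected = ∀ u v → Walk u v

IsMinSize : {n : ℕ} → (Subset n → Set) → ℕ → Set
IsMinSize P m = (Σ _ λ C → P C × ∣ C ∣ ≡ m) × (∀ C → P C → m ≤ ∣ C ∣)

γL≡ : {n : ℕ} → Graph n → ℕ → Set
γL≡ G m = IsMinSize (LocatingDominating G) m

γtID≡ : {n : ℕ} → Graph n → ℕ → Set
γtID≡ G m = IsMinSize (TotalDominatingIdentifyingCode G) m

-- G_k has hubs z_i (i < k), each carrying a pendant leaf y_i, and for every subset s of
-- {0, …, k-1} with at least two elements a gadget a_s, b_s, c_s, d_s: a_s and c_s are joined to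
-- the hubs of s, a_s to b_s, c_s, d_s, and b_s to c_s, d_s.  The hubs together with the d_s form
-- a locating-dominating set, and the hubs together with all a_s, c_s, d_s a total dominating
-- identifying code.  Conversely N[b_s] and N[d_s] differ only in c_s, and N[a_s] and N[c_s]
-- only in d_s.  So a locating-dominating set contains z_i or y_i for every i and one of b_s,
-- c_s, d_s for every s; a total dominating identifying code contains every z_i (the only
-- neighbour of y_i), every c_s and d_s, and one of a_s, b_s (the neighbours of d_s).  With
-- 2^k - k - 1 gadgets this gives γL = 2^k - 1 and γtID = k + 3 (2^k - k - 1) = 3·2^k - 2k - 3.

{-# OPTIONS --safe #-}
module Submission where

open import Defs hiding (sym)
open import Data.Bool using (Bool; true; false; T; _∨_; _∧_)
open import Data.Bool.Properties using (T-∨; ∨-identityʳ; ∨-comm; ∧-zeroʳ)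
open import Data.Empty using (⊥; ⊥-elim)
open import Data.Fin using (Fin; zero; suc; _↑ˡ_; _↑ʳ_; _≟_)
open import Data.Fin.Properties
  using (+↔⊎; 0↔⊥; 1↔⊤; splitAt-↑ˡ; splitAt-↑ʳ; suc-injective)
open import Data.Fin.Subset
  using (Subset; inside; outside; ∣_∣; _∈_; _∉_; _∩_) renaming (⊥ to ∅)
open import Data.Fin.Subset.Properties using (x∈p∩q⁺; x∈p∩q⁻; drop-there; ∉⊥)
open import Data.Nat using (ℕ; zero; suc; _+_; _*_; _∸_; _^_; _≤_; z≤n; s≤s)
open import Data.Nat.Logarithm using (⌊log₂_⌋; ⌊log₂[2^n]⌋≡n)
open import Data.Nat.Properties
  using (+-mono-≤; +-monoʳ-≤; +-monoˡ-≤; +-assoc; +-suc; m≤n+m; m+n∸n≡m; n≤1+n;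
         ≤-trans; ≤-reflexive; module ≤-Reasoning)
open import Data.Nat.Tactic.RingSolver using (solve-∀)
open import Data.Product using (Σ; _,_; proj₁; _×_; ∃)
open import Data.Sum using (_⊎_; inj₁; inj₂; map; swap; [_,_])
open import Data.Sum.Function.Propositional using (_⊎-↔_)
open import Data.Sum.Properties using (≡-dec; inj₁-injective)
open import Data.Unit using (⊤)
open import Data.Vec using (_∷_; []; lookup; tabulate; here; there)
open import Data.Vec.Properties using (lookup∘tabulate; lookup-zipWith; ∷-injectiveʳ)
open import Data.Vec.Relation.Binary.Pointwise.Extensional using (ext; Pointwise-≡⇒≡)
open import Function using (_∘_)
open import Function.Bundles using (_↔_; Inverse; Injection; Equivalence)
open import Function.Definitions using (Injective)
open import Function.Properties.Inverse using (↔-refl; ↔-trans; Inverse⇒Injection)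
open import Relation.Binary.Definitions using (DecidableEquality)
open import Relation.Binary.PropositionalEquality
  using (_≡_; _≢_; ≢-sym; refl; sym; trans; cong; cong₂; subst; _≗_; module ≡-Reasoning)
open import Relation.Nullary using (¬_; Dec; does; yes; no)
open import Relation.Nullary.Decidable using (⌊_⌋; dec-false)

does-complete : ∀ {A : Set} (a? : Dec A) → A → T (does a?)
does-complete (yes _) _ = _
does-complete (no ¬a) a = ¬a a

does-sound : ∀ {A : Set} (a? : Dec A) → T (does a?) → A
does-sound (yes a) _ = a

does-≟-sym : ∀ {A : Set} (_≟_ : DecidableEquality A) x y → does (x ≟ y) ≡ does (y ≟ x)
does-≟-sym _≟_ x y with x ≟ y | y ≟ x
... | yes _   | yes _   = refl
... | no _    | no _    = refl
... | yes x≡y | no y≢x  = ⊥-elim (y≢x (sym x≡y))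
... | no x≢y  | yes y≡x = ⊥-elim (x≢y (sym y≡x))

does-≟-injective : ∀ {A B : Set} (_≟A_ : DecidableEquality A) (_≟B_ : DecidableEquality B)
                   {f : A → B} → Injective _≡_ _≡_ f →
                   ∀ x y → ⌊ x ≟A y ⌋ ≡ does (f x ≟B f y)
does-≟-injective _≟A_ _≟B_ {f} f-injective x y with x ≟A y | f x ≟B f y
... | yes _    | yes _     = refl
... | no _     | no _      = refl
... | yes refl | no fx≢fx  = ⊥-elim (fx≢fx refl)
... | no x≢y   | yes fx≡fy = ⊥-elim (x≢y (f-injective fx≡fy))

≟-refl : ∀ {m} (s : Fin m) → T (does (s ≟ s))
≟-refl s = does-complete (s ≟ s) refl

≟-¬ : ∀ {m} {s t : Fin m} → s ≢ t → ¬ T (does (s ≟ t))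
≟-¬ {s = s} {t} s≢t = s≢t ∘ does-sound (s ≟ t)

∈⇒T : ∀ {n} {x : Fin n} {C : Subset n} → x ∈ C → T (lookup C x)
∈⇒T here      = _
∈⇒T (there x) = ∈⇒T x

T⇒∈ : ∀ {n} {x : Fin n} {C : Subset n} → T (lookup C x) → x ∈ C
T⇒∈ {x = zero}  {inside ∷ C} _ = here
T⇒∈ {x = suc x} {_      ∷ C} t = there (T⇒∈ t)

∉⇒lookup≡false : ∀ {n} {x : Fin n} {C : Subset n} → x ∉ C → lookup C x ≡ false
∉⇒lookup≡false {x = zero}  {inside  ∷ C} x∉C = ⊥-elim (x∉C here)
∉⇒lookup≡false {x = zero}  {outside ∷ C} x∉C = refl
∉⇒lookup≡false {x = suc x} {_       ∷ C} x∉C = ∉⇒lookup≡false (x∉C ∘ there)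

there-∈∉ : ∀ {n x y} {i : Fin n} {p q : Subset n} →
           i ∈ p × i ∉ q → suc i ∈ x ∷ p × suc i ∉ y ∷ q
there-∈∉ (i∈p , i∉q) = there i∈p , i∉q ∘ drop-there

distinct-subsets-differ : ∀ {n} {p q : Subset n} → p ≢ q →
                          ∃ λ x → (x ∈ p × x ∉ q) ⊎ (x ∈ q × x ∉ p)
distinct-subsets-differ {p = []}          {[]}          p≢q = ⊥-elim (p≢q refl)
distinct-subsets-differ {p = inside  ∷ p} {outside ∷ q} _   = zero , inj₁ (here , λ ())
distinct-subsets-differ {p = outside ∷ p} {inside  ∷ q} _   = zero , inj₂ (here , λ ())
distinct-subsets-differ {p = inside  ∷ p} {inside  ∷ q} p≢q =
  let i , d = distinct-subsets-differ (p≢q ∘ cong (inside ∷_))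
  in  suc i , map there-∈∉ there-∈∉ d
distinct-subsets-differ {p = outside ∷ p} {outside ∷ q} p≢q =
  let i , d = distinct-subsets-differ (p≢q ∘ cong (outside ∷_))
  in  suc i , map there-∈∉ there-∈∉ d

count : ∀ {n} → (Fin n → Bool) → ℕ
count {zero}  f = 0
count {suc n} f with f zero
... | true  = suc (count (f ∘ suc))
... | false = count (f ∘ suc)

count-cong : ∀ {n} {f g : Fin n → Bool} → f ≗ g → count f ≡ count g
count-cong {zero}          f≗g = refl
count-cong {suc n} {f} {g} f≗g with f zero | g zero | f≗g zero
... | true  | true  | refl = cong suc (count-cong (f≗g ∘ suc))
... | false | false | refl = count-cong (f≗g ∘ suc)

∣∣≡count-lookup : ∀ {n} (C : Subset n) → ∣ C ∣ ≡ count (lookup C)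
∣∣≡count-lookup []            = refl
∣∣≡count-lookup (inside  ∷ C) = cong suc (∣∣≡count-lookup C)
∣∣≡count-lookup (outside ∷ C) = ∣∣≡count-lookup C

∣tabulate∣≡count : ∀ {n} (f : Fin n → Bool) → ∣ tabulate f ∣ ≡ count f
∣tabulate∣≡count f = trans (∣∣≡count-lookup (tabulate f)) (count-cong (lookup∘tabulate f))

count-↑ : ∀ m {n} (f : Fin (m + n) → Bool) →
          count f ≡ count (f ∘ (_↑ˡ n)) + count (f ∘ (m ↑ʳ_))
count-↑ zero    f = refl
count-↑ (suc m) f with f zero
... | true  = cong suc (count-↑ m (f ∘ suc))
... | false = count-↑ m (f ∘ suc)

count-true : ∀ {n} {f : Fin n → Bool} → (∀ i → T (f i)) → count f ≡ n
count-true {zero}      _ = refl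
count-true {suc n} {f} t with f zero | t zero
... | true | _ = cong suc (count-true (t ∘ suc))

count-false : ∀ n → count {n} (λ _ → false) ≡ 0
count-false zero    = refl
count-false (suc n) = count-false n

count-∨ : ∀ {n} (f g : Fin n → Bool) → count (λ i → f i ∨ g i) ≤ count f + count g
count-∨ {zero}  f g = z≤n
count-∨ {suc n} f g with f zero | g zero
... | true  | true  = s≤s (≤-trans (count-∨ (f ∘ suc) (g ∘ suc))
                                   (+-monoʳ-≤ (count (f ∘ suc)) (n≤1+n _)))
... | true  | false = s≤s (count-∨ (f ∘ suc) (g ∘ suc))
... | false | true  = ≤-trans (s≤s (count-∨ (f ∘ suc) (g ∘ suc))) (≤-reflexive (sym (+-suc _ _)))
... | false | false = count-∨ (f ∘ suc) (g ∘ suc)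

≤-count-∨ : ∀ {n} (f g : Fin n → Bool) → (∀ i → T (f i ∨ g i)) → n ≤ count f + count g
≤-count-∨ f g f∨g =
  ≤-trans (≤-reflexive (sym (count-true {f = λ i → f i ∨ g i} f∨g))) (count-∨ f g)

infixr 4 _⊕_
_⊕_ : ∀ {m n} {A B : Set} → Fin m ↔ A → Fin n ↔ B → Fin (m + n) ↔ (A ⊎ B)
e₁ ⊕ e₂ = ↔-trans +↔⊎ (e₁ ⊎-↔ e₂)

count-⊕ : ∀ {m n} {A B : Set} (e₁ : Fin m ↔ A) (e₂ : Fin n ↔ B) (h : A ⊎ B → Bool) →
          count (h ∘ Inverse.to (e₁ ⊕ e₂))
            ≡ count (h ∘ inj₁ ∘ Inverse.to e₁) + count (h ∘ inj₂ ∘ Inverse.to e₂)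
count-⊕ {m} {n} e₁ e₂ h = trans (count-↑ m _) (cong₂ _+_
  (count-cong λ i → cong (h ∘ map (Inverse.to e₁) (Inverse.to e₂)) (splitAt-↑ˡ m i n))
  (count-cong λ i → cong (h ∘ map (Inverse.to e₁) (Inverse.to e₂)) (splitAt-↑ʳ m n i)))

module _ {n : ℕ} (G : Graph n) where

  infixr 5 _◅◅_
  _◅◅_ : ∀ {u v w} → Walk G u v → Walk G v w → Walk G u w
  here     ◅◅ q = q
  step e p ◅◅ q = step e (p ◅◅ q)

  Adj-sym : ∀ {u v} → Adj G u v → Adj G v u
  Adj-sym {u} {v} = subst T (Graph.sym G u v)

  reverse : ∀ {u v} → Walk G u v → Walk G v u
  reverse here       = here
  reverse (step e p) = reverse p ◅◅ step (Adj-sym e) here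

  connected-via : (w : Fin n) → (∀ u → Walk G u w) → Connected G
  connected-via w walk u v = walk u ◅◅ reverse (walk v)

  lookup-N : ∀ v x → lookup (N[ G ] v) x ≡ adj G v x ∨ ⌊ v ≟ x ⌋
  lookup-N v = lookup∘tabulate _

  lookup-I : ∀ C v x → lookup (I G C v) x ≡ lookup (N[ G ] v) x ∧ lookup C x
  lookup-I C v x = lookup-zipWith _∧_ x (N[ G ] v) C

  witness⇒I-≢ : ∀ {C u v w} → w ∈ C → w ∈ N[ G ] u → w ∉ N[ G ] v → I G C u ≢ I G C v
  witness⇒I-≢ {C} {v = v} w∈C w∈Nu w∉Nv Iu≡Iv =
    w∉Nv (proj₁ (x∈p∩q⁻ (N[ G ] v) C (subst (_ ∈_) Iu≡Iv (x∈p∩q⁺ (w∈Nu , w∈C)))))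

  N[]-agree⇒I-≡ : ∀ {C u v w} → w ∉ C →
                  (∀ x → x ≢ w → lookup (N[ G ] u) x ≡ lookup (N[ G ] v) x) →
                  I G C u ≡ I G C v
  N[]-agree⇒I-≡ {C} {u} {v} {w} w∉C agree = Pointwise-≡⇒≡ (ext λ x →
    trans (lookup-I C u x) (trans (agree-at x) (sym (lookup-I C v x))))
    where
    agree-at : ∀ x → lookup (N[ G ] u) x ∧ lookup C x ≡ lookup (N[ G ] v) x ∧ lookup C x
    agree-at x with x ≟ w
    ... | yes refl rewrite ∉⇒lookup≡false w∉C = trans (∧-zeroʳ _) (sym (∧-zeroʳ _))
    ... | no x≢w   = cong (_∧ lookup C x) (agree x x≢w)

  TDID⇒identifiable : ∀ {C} → TotalDominatingIdentifyingCode G C → Identifiable G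
  TDID⇒identifiable {C} (total , identifying) =
      (λ u v u≢v Nu≡Nv → identifying u v u≢v (cong (_∩ C) Nu≡Nv))
    , (λ v → let w , _ , v∼w = total v in w , v∼w)

-- The graph G_k, built from an arbitrary family F of distinct subsets with at least two elements

module Construction
  (k g : ℕ) (F : Fin g → Subset k) (F-injective : Injective _≡_ _≡_ F)
  (F-large : ∀ s i → ∃ λ j → j ≢ i × j ∈ F s)
  (z₀ : Fin k) (F-links : ∀ i → ∃ λ s → i ∈ F s × z₀ ∈ F s)
  where

  Vertex : Set
  Vertex = Fin k ⊎ Fin k ⊎ Fin g ⊎ Fin g ⊎ Fin g ⊎ Fin g

  pattern z i = inj₁ i
  pattern y i = inj₂ (inj₁ i)
  pattern a s = inj₂ (inj₂ (inj₁ s))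
  pattern b s = inj₂ (inj₂ (inj₂ (inj₁ s)))
  pattern c s = inj₂ (inj₂ (inj₂ (inj₂ (inj₁ s))))
  pattern d s = inj₂ (inj₂ (inj₂ (inj₂ (inj₂ s))))

  n : ℕ
  n = k + (k + (g + (g + (g + g))))

  enumeration : Fin n ↔ Vertex
  enumeration = ↔-refl ⊕ ↔-refl ⊕ ↔-refl ⊕ ↔-refl ⊕ ↔-refl ⊕ ↔-refl

  open Inverse enumeration using ()
    renaming (to to vertex; from to index; strictlyInverseˡ to vertex-index;
              strictlyInverseʳ to index-vertex)

  vertex-injective : Injective _≡_ _≡_ vertex
  vertex-injective {u} {v} eq =
    trans (sym (index-vertex u)) (trans (cong index eq) (index-vertex v))

  index-≢ : ∀ p q → p ≢ q → index p ≢ index q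
  index-≢ p q p≢q eq = p≢q (trans (sym (vertex-index p)) (trans (cong vertex eq) (vertex-index q)))

  _≟ᵥ_ : DecidableEquality Vertex
  _≟ᵥ_ = ≡-dec _≟_ (≡-dec _≟_ (≡-dec _≟_ (≡-dec _≟_ (≡-dec _≟_ _≟_))))

  edge : Vertex → Vertex → Bool
  edge (z i) (y j) = does (i ≟ j)
  edge (z i) (a s) = lookup (F s) i
  edge (z i) (c s) = lookup (F s) i
  edge (a s) (b t) = does (s ≟ t)
  edge (a s) (c t) = does (s ≟ t)
  edge (a s) (d t) = does (s ≟ t)
  edge (b s) (c t) = does (s ≟ t)
  edge (b s) (d t) = does (s ≟ t)
  edge _     _     = false

  _∼_ : Vertex → Vertex → Bool
  p ∼ q = edge p q ∨ edge q p

  ∼-irrefl : ∀ p → p ∼ p ≡ false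
  ∼-irrefl (z _) = refl
  ∼-irrefl (y _) = refl
  ∼-irrefl (a _) = refl
  ∼-irrefl (b _) = refl
  ∼-irrefl (c _) = refl
  ∼-irrefl (d _) = refl

  G : Graph n
  G = record
    { adj   = λ u v → vertex u ∼ vertex v
    ; sym   = λ u v → ∨-comm (edge (vertex u) (vertex v)) _
    ; irref = ∼-irrefl ∘ vertex
    }

  -- does rather than ⌊_⌋: does computes through the map′ in ≡-dec, so that for instance
  -- nbhd (b s) (b t) reduces to does (s ≟ t).
  nbhd : Vertex → Vertex → Bool
  nbhd p r = p ∼ r ∨ does (p ≟ᵥ r)

  lookup-N[] : ∀ u x → lookup (N[ G ] u) x ≡ nbhd (vertex u) (vertex x)
  lookup-N[] u x = trans (lookup-N G u x)
    (cong (vertex u ∼ vertex x ∨_) (does-≟-injective _≟_ _≟ᵥ_ vertex-injective u x))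

  lookup-N[]-index : ∀ u r → lookup (N[ G ] u) (index r) ≡ nbhd (vertex u) r
  lookup-N[]-index u r = trans (lookup-N[] u (index r)) (cong (nbhd (vertex u)) (vertex-index r))

  lookup-N[index] : ∀ p x → lookup (N[ G ] (index p)) x ≡ nbhd p (vertex x)
  lookup-N[index] p x =
    trans (lookup-N[] (index p) x) (cong (λ q → nbhd q (vertex x)) (vertex-index p))

  edge→∼ : ∀ p r → T (edge p r) → T (p ∼ r)
  edge→∼ p r = Equivalence.from (T-∨ {edge p r}) ∘ inj₁

  edge←∼ : ∀ p r → T (edge r p) → T (p ∼ r)
  edge←∼ p r = Equivalence.from (T-∨ {edge p r}) ∘ inj₂

  nbhd-refl : ∀ p → T (nbhd p p)
  nbhd-refl p = Equivalence.from (T-∨ {p ∼ p}) (inj₂ (does-complete (p ≟ᵥ p) refl))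

  ∼→nbhd : ∀ p r → T (p ∼ r) → T (nbhd p r)
  ∼→nbhd p r = Equivalence.from (T-∨ {p ∼ r}) ∘ inj₁

  edge→nbhd : ∀ p r → T (edge p r) → T (nbhd p r)
  edge→nbhd p r = ∼→nbhd p r ∘ edge→∼ p r

  edge←nbhd : ∀ p r → T (edge r p) → T (nbhd p r)
  edge←nbhd p r = ∼→nbhd p r ∘ edge←∼ p r

  nbhd-¬ : ∀ p r → p ≢ r → ¬ T (edge p r) → ¬ T (edge r p) → ¬ T (nbhd p r)
  nbhd-¬ p r p≢r ¬pr ¬rp t with Equivalence.to (T-∨ {p ∼ r}) t
  ... | inj₂ p≡r = p≢r (does-sound (p ≟ᵥ r) p≡r)
  ... | inj₁ p∼r = [ ¬pr , ¬rp ] (Equivalence.to (T-∨ {edge p r}) p∼r)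

  some-element : ∀ s → ∃ λ i → i ∈ F s
  some-element s = let i , _ , i∈s = F-large s z₀ in i , i∈s

  code : (Vertex → Bool) → Subset n
  code h = tabulate (h ∘ vertex)

  ld : Vertex → Bool
  ld (z _) = true
  ld (d _) = true
  ld _     = false

  tdid : Vertex → Bool
  tdid (y _) = false
  tdid (b _) = false
  tdid _     = true

  ∈-code : ∀ h u → T (h (vertex u)) → u ∈ code h
  ∈-code h u = T⇒∈ ∘ subst T (sym (lookup∘tabulate (h ∘ vertex) u))

  index-∈-code : ∀ h r → T (h r) → index r ∈ code h
  index-∈-code h r = ∈-code h (index r) ∘ subst T (cong h (sym (vertex-index r)))

  index-∈N[] : ∀ u r → T (nbhd (vertex u) r) → index r ∈ N[ G ] u
  index-∈N[] u r = T⇒∈ ∘ subst T (sym (lookup-N[]-index u r))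

  index-∉N[] : ∀ u r → ¬ T (nbhd (vertex u) r) → index r ∉ N[ G ] u
  index-∉N[] u r r∉Nu = r∉Nu ∘ subst T (lookup-N[]-index u r) ∘ ∈⇒T

  index-Adj : ∀ u r → T (vertex u ∼ r) → Adj G u (index r)
  index-Adj u r = subst T (cong (vertex u ∼_) (sym (vertex-index r)))

  Separates : (Vertex → Bool) → Vertex → Vertex → Set
  Separates h p q = ∃ λ r → T (h r) × T (nbhd p r) × ¬ T (nbhd q r)

  Separated : (Vertex → Bool) → Vertex → Vertex → Set
  Separated h p q = Separates h p q ⊎ Separates h q p

  separated⇒I-≢ : ∀ h u v → Separated h (vertex u) (vertex v) → I G (code h) u ≢ I G (code h) v
  separated⇒I-≢ h u v (inj₁ (r , r∈h , r∈Nu , r∉Nv)) =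
    witness⇒I-≢ G (index-∈-code h r r∈h) (index-∈N[] u r r∈Nu) (index-∉N[] v r r∉Nv)
  separated⇒I-≢ h u v (inj₂ (r , r∈h , r∈Nv , r∉Nu)) =
    ≢-sym (witness⇒I-≢ G (index-∈-code h r r∈h) (index-∈N[] v r r∈Nv) (index-∉N[] u r r∉Nu))

  separate-ld : ∀ p q → ¬ T (ld p) → ¬ T (ld q) → p ≢ q → Separated ld p q
  separate-ld (z _) _     p∉ _  _ = ⊥-elim (p∉ _)
  separate-ld (d _) _     p∉ _  _ = ⊥-elim (p∉ _)
  separate-ld _     (z _) _  q∉ _ = ⊥-elim (q∉ _)
  separate-ld _     (d _) _  q∉ _ = ⊥-elim (q∉ _)
  separate-ld (y i) (y j) _ _ p≢q =
    inj₁ (z i , _ , edge←nbhd (y i) (z i) (≟-refl i) ,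
          nbhd-¬ (y j) (z i) (λ ()) (λ ()) (≟-¬ (p≢q ∘ cong y)))
  separate-ld (y i) (a s) _ _ _ = inj₂ (d s , _ , edge→nbhd (a s) (d s) (≟-refl s) , λ ())
  separate-ld (y i) (b s) _ _ _ = inj₂ (d s , _ , edge→nbhd (b s) (d s) (≟-refl s) , λ ())
  separate-ld (y i) (c s) _ _ _ =
    let j , j≢i , j∈s = F-large s i
    in  inj₂ (z j , _ , edge←nbhd (c s) (z j) (∈⇒T j∈s) ,
              nbhd-¬ (y i) (z j) (λ ()) (λ ()) (≟-¬ j≢i))
  separate-ld (a s) (a t) _ _ p≢q =
    inj₁ (d s , _ , edge→nbhd (a s) (d s) (≟-refl s) ,
          nbhd-¬ (a t) (d s) (λ ()) (≟-¬ (p≢q ∘ cong a ∘ sym)) (λ ()))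
  separate-ld (a s) (b t) _ _ _ =
    let i , i∈s = some-element s in inj₁ (z i , _ , edge←nbhd (a s) (z i) (∈⇒T i∈s) , λ ())
  separate-ld (a s) (c t) _ _ _ = inj₁ (d s , _ , edge→nbhd (a s) (d s) (≟-refl s) , λ ())
  separate-ld (b s) (b t) _ _ p≢q =
    inj₁ (d s , _ , edge→nbhd (b s) (d s) (≟-refl s) ,
          nbhd-¬ (b t) (d s) (λ ()) (≟-¬ (p≢q ∘ cong b ∘ sym)) (λ ()))
  separate-ld (b s) (c t) _ _ _ = inj₁ (d s , _ , edge→nbhd (b s) (d s) (≟-refl s) , λ ())
  separate-ld (c s) (c t) _ _ p≢q with distinct-subsets-differ (p≢q ∘ cong c ∘ F-injective)
  ... | i , inj₁ (i∈s , i∉t) =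
    inj₁ (z i , _ , edge←nbhd (c s) (z i) (∈⇒T i∈s) , nbhd-¬ (c t) (z i) (λ ()) (λ ()) (i∉t ∘ T⇒∈))
  ... | i , inj₂ (i∈t , i∉s) =
    inj₂ (z i , _ , edge←nbhd (c t) (z i) (∈⇒T i∈t) , nbhd-¬ (c s) (z i) (λ ()) (λ ()) (i∉s ∘ T⇒∈))
  separate-ld p@(a _) q@(y _) p∉ q∉ p≢q = swap (separate-ld q p q∉ p∉ (≢-sym p≢q))
  separate-ld p@(b _) q@(y _) p∉ q∉ p≢q = swap (separate-ld q p q∉ p∉ (≢-sym p≢q))
  separate-ld p@(c _) q@(y _) p∉ q∉ p≢q = swap (separate-ld q p q∉ p∉ (≢-sym p≢q))
  separate-ld p@(b _) q@(a _) p∉ q∉ p≢q = swap (separate-ld q p q∉ p∉ (≢-sym p≢q))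
  separate-ld p@(c _) q@(a _) p∉ q∉ p≢q = swap (separate-ld q p q∉ p∉ (≢-sym p≢q))
  separate-ld p@(c _) q@(b _) p∉ q∉ p≢q = swap (separate-ld q p q∉ p∉ (≢-sym p≢q))

  separate-tdid : ∀ p q → p ≢ q → Separated tdid p q
  separate-tdid (z i) (z j) p≢q =
    inj₁ (z i , _ , nbhd-refl (z i) , nbhd-¬ (z j) (z i) (≢-sym p≢q) (λ ()) (λ ()))
  separate-tdid (z i) (y j) _ =
    let s , i∈s , _ = F-links i in inj₁ (a s , _ , edge→nbhd (z i) (a s) (∈⇒T i∈s) , λ ())
  separate-tdid (z i) (a s) _ = inj₂ (d s , _ , edge→nbhd (a s) (d s) (≟-refl s) , λ ())
  separate-tdid (z i) (b s) _ = inj₂ (d s , _ , edge→nbhd (b s) (d s) (≟-refl s) , λ ())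
  separate-tdid (z i) (c s) _ =
    let j , j≢i , j∈s = F-large s i
    in  inj₂ (z j , _ , edge←nbhd (c s) (z j) (∈⇒T j∈s) ,
              nbhd-¬ (z i) (z j) (j≢i ∘ sym ∘ inj₁-injective) (λ ()) (λ ()))
  separate-tdid (z i) (d s) _ = inj₂ (d s , _ , nbhd-refl (d s) , λ ())
  separate-tdid (y i) (y j) p≢q =
    inj₁ (z i , _ , edge←nbhd (y i) (z i) (≟-refl i) ,
          nbhd-¬ (y j) (z i) (λ ()) (λ ()) (≟-¬ (p≢q ∘ cong y)))
  separate-tdid (y i) (a s) _ = inj₂ (a s , _ , nbhd-refl (a s) , λ ())
  separate-tdid (y i) (b s) _ = inj₂ (a s , _ , edge←nbhd (b s) (a s) (≟-refl s) , λ ())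
  separate-tdid (y i) (c s) _ = inj₂ (a s , _ , edge←nbhd (c s) (a s) (≟-refl s) , λ ())
  separate-tdid (y i) (d s) _ = inj₂ (a s , _ , edge←nbhd (d s) (a s) (≟-refl s) , λ ())
  separate-tdid (a s) (a t) p≢q =
    inj₁ (a s , _ , nbhd-refl (a s) , nbhd-¬ (a t) (a s) (≢-sym p≢q) (λ ()) (λ ()))
  separate-tdid (a s) (b t) _ =
    let i , i∈s = some-element s in inj₁ (z i , _ , edge←nbhd (a s) (z i) (∈⇒T i∈s) , λ ())
  separate-tdid (a s) (c t) _ = inj₁ (d s , _ , edge→nbhd (a s) (d s) (≟-refl s) , λ ())
  separate-tdid (a s) (d t) _ =
    let i , i∈s = some-element s in inj₁ (z i , _ , edge←nbhd (a s) (z i) (∈⇒T i∈s) , λ ())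
  separate-tdid (b s) (b t) p≢q =
    inj₁ (a s , _ , edge←nbhd (b s) (a s) (≟-refl s) ,
          nbhd-¬ (b t) (a s) (λ ()) (λ ()) (≟-¬ (p≢q ∘ cong b)))
  separate-tdid (b s) (c t) _ = inj₁ (d s , _ , edge→nbhd (b s) (d s) (≟-refl s) , λ ())
  separate-tdid (b s) (d t) _ = inj₁ (c s , _ , edge→nbhd (b s) (c s) (≟-refl s) , λ ())
  separate-tdid (c s) (c t) p≢q =
    inj₁ (c s , _ , nbhd-refl (c s) , nbhd-¬ (c t) (c s) (≢-sym p≢q) (λ ()) (λ ()))
  separate-tdid (c s) (d t) _ =
    let i , i∈s = some-element s in inj₁ (z i , _ , edge←nbhd (c s) (z i) (∈⇒T i∈s) , λ ())
  separate-tdid (d s) (d t) p≢q =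
    inj₁ (d s , _ , nbhd-refl (d s) , nbhd-¬ (d t) (d s) (≢-sym p≢q) (λ ()) (λ ()))
  separate-tdid p@(y _) q@(z _) p≢q = swap (separate-tdid q p (≢-sym p≢q))
  separate-tdid p@(a _) q@(z _) p≢q = swap (separate-tdid q p (≢-sym p≢q))
  separate-tdid p@(b _) q@(z _) p≢q = swap (separate-tdid q p (≢-sym p≢q))
  separate-tdid p@(c _) q@(z _) p≢q = swap (separate-tdid q p (≢-sym p≢q))
  separate-tdid p@(d _) q@(z _) p≢q = swap (separate-tdid q p (≢-sym p≢q))
  separate-tdid p@(a _) q@(y _) p≢q = swap (separate-tdid q p (≢-sym p≢q))
  separate-tdid p@(b _) q@(y _) p≢q = swap (separate-tdid q p (≢-sym p≢q))
  separate-tdid p@(c _) q@(y _) p≢q = swap (separate-tdid q p (≢-sym p≢q))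
  separate-tdid p@(d _) q@(y _) p≢q = swap (separate-tdid q p (≢-sym p≢q))
  separate-tdid p@(b _) q@(a _) p≢q = swap (separate-tdid q p (≢-sym p≢q))
  separate-tdid p@(c _) q@(a _) p≢q = swap (separate-tdid q p (≢-sym p≢q))
  separate-tdid p@(d _) q@(a _) p≢q = swap (separate-tdid q p (≢-sym p≢q))
  separate-tdid p@(c _) q@(b _) p≢q = swap (separate-tdid q p (≢-sym p≢q))
  separate-tdid p@(d _) q@(b _) p≢q = swap (separate-tdid q p (≢-sym p≢q))
  separate-tdid p@(d _) q@(c _) p≢q = swap (separate-tdid q p (≢-sym p≢q))

  ld-dominator : ∀ p → ∃ λ r → T (ld r) × T (nbhd p r)
  ld-dominator (z i) = z i , _ , nbhd-refl (z i)
  ld-dominator (y i) = z i , _ , edge←nbhd (y i) (z i) (≟-refl i)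
  ld-dominator (a s) = d s , _ , edge→nbhd (a s) (d s) (≟-refl s)
  ld-dominator (b s) = d s , _ , edge→nbhd (b s) (d s) (≟-refl s)
  ld-dominator (c s) = let i , i∈s = some-element s in z i , _ , edge←nbhd (c s) (z i) (∈⇒T i∈s)
  ld-dominator (d s) = d s , _ , nbhd-refl (d s)

  ld-locating-dominating : LocatingDominating G (code ld)
  ld-locating-dominating =
      (λ u → let r , r∈L , r∈Nu = ld-dominator (vertex u) in
             index r , index-∈-code ld r r∈L , index-∈N[] u r r∈Nu)
    , (λ u v u∉L v∉L u≢v → separated⇒I-≢ ld u v (separate-ld (vertex u) (vertex v)
             (u∉L ∘ ∈-code ld u) (v∉L ∘ ∈-code ld v) (u≢v ∘ vertex-injective)))

  tdid-neighbour : ∀ p → ∃ λ r → T (tdid r) × T (p ∼ r)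
  tdid-neighbour (z i) = let s , i∈s , _ = F-links i in a s , _ , edge→∼ (z i) (a s) (∈⇒T i∈s)
  tdid-neighbour (y i) = z i , _ , edge←∼ (y i) (z i) (≟-refl i)
  tdid-neighbour (a s) = c s , _ , edge→∼ (a s) (c s) (≟-refl s)
  tdid-neighbour (b s) = a s , _ , edge←∼ (b s) (a s) (≟-refl s)
  tdid-neighbour (c s) = a s , _ , edge←∼ (c s) (a s) (≟-refl s)
  tdid-neighbour (d s) = a s , _ , edge←∼ (d s) (a s) (≟-refl s)

  tdid-total-dominating-identifying : TotalDominatingIdentifyingCode G (code tdid)
  tdid-total-dominating-identifying =
      (λ u → let r , r∈D , u∼r = tdid-neighbour (vertex u) in
             index r , index-∈-code tdid r r∈D , index-Adj u r u∼r)
    , (λ u v u≢v → separated⇒I-≢ tdid u v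
             (separate-tdid (vertex u) (vertex v) (u≢v ∘ vertex-injective)))

  count-vertex : ∀ h → count (h ∘ vertex) ≡ count (h ∘ z) + (count (h ∘ y)
                       + (count (h ∘ a) + (count (h ∘ b) + (count (h ∘ c) + count (h ∘ d)))))
  count-vertex h =
    trans (count-⊕ id (id ⊕ id ⊕ id ⊕ id ⊕ id) h) (cong (count (h ∘ z) +_)
    (trans (count-⊕ id (id ⊕ id ⊕ id ⊕ id) (h ∘ inj₂)) (cong (count (h ∘ y) +_)
    (trans (count-⊕ id (id ⊕ id ⊕ id) (h ∘ inj₂ ∘ inj₂)) (cong (count (h ∘ a) +_)
    (trans (count-⊕ id (id ⊕ id) (h ∘ inj₂ ∘ inj₂ ∘ inj₂)) (cong (count (h ∘ b) +_)
    (count-⊕ id id (h ∘ inj₂ ∘ inj₂ ∘ inj₂ ∘ inj₂)))))))))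
    where
    id : ∀ {m} → Fin m ↔ Fin m
    id = ↔-refl

  ∣code-ld∣ : ∣ code ld ∣ ≡ k + g
  ∣code-ld∣ = trans (∣tabulate∣≡count (ld ∘ vertex)) (trans (count-vertex ld)
    (cong₂ _+_ (count-true {f = ld ∘ z} _) (cong₂ _+_ (count-false k) (cong₂ _+_ (count-false g)
    (cong₂ _+_ (count-false g) (cong₂ _+_ (count-false g) (count-true {f = ld ∘ d} _)))))))

  ∣code-tdid∣ : ∣ code tdid ∣ ≡ k + (g + (g + g))
  ∣code-tdid∣ = trans (∣tabulate∣≡count (tdid ∘ vertex)) (trans (count-vertex tdid)
    (cong₂ _+_ (count-true {f = tdid ∘ z} _) (cong₂ _+_ (count-false k)
    (cong₂ _+_ (count-true {f = tdid ∘ a} _) (cong₂ _+_ (count-false g)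
    (cong₂ _+_ (count-true {f = tdid ∘ c} _) (count-true {f = tdid ∘ d} _)))))))

  nbhd-y : ∀ i r → T (nbhd (y i) r) → r ≡ z i ⊎ r ≡ y i
  nbhd-y i (z j) t = inj₁ (cong z (does-sound (j ≟ i) (subst T (∨-identityʳ _) t)))
  nbhd-y i (y j) t = inj₂ (sym (does-sound (y i ≟ᵥ y j) t))
  nbhd-y i (a _) ()
  nbhd-y i (b _) ()
  nbhd-y i (c _) ()
  nbhd-y i (d _) ()

  ∼-y : ∀ i r → T (y i ∼ r) → r ≡ z i
  ∼-y i (z j) t = cong z (does-sound (j ≟ i) t)
  ∼-y i (y _) ()
  ∼-y i (a _) ()
  ∼-y i (b _) ()
  ∼-y i (c _) ()
  ∼-y i (d _) ()

  ∼-d : ∀ s r → T (d s ∼ r) → r ≡ a s ⊎ r ≡ b s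
  ∼-d s (a t) e = inj₁ (cong a (does-sound (t ≟ s) e))
  ∼-d s (b t) e = inj₂ (cong b (does-sound (t ≟ s) e))
  ∼-d s (z _) ()
  ∼-d s (y _) ()
  ∼-d s (c _) ()
  ∼-d s (d _) ()

  b-d-twins : ∀ s r → r ≢ c s → nbhd (b s) r ≡ nbhd (d s) r
  b-d-twins s (z _) _    = refl
  b-d-twins s (y _) _    = refl
  b-d-twins s (a _) _    = refl
  b-d-twins s (b t) _    = trans (does-≟-sym _≟_ s t) (sym (∨-identityʳ _))
  b-d-twins s (c t) r≢cs =
    trans (trans (∨-identityʳ _) (∨-identityʳ _)) (dec-false (s ≟ t) (r≢cs ∘ cong c ∘ sym))
  b-d-twins s (d t) _    = trans (∨-identityʳ _) (∨-identityʳ _)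

  a-c-twins : ∀ s r → r ≢ d s → nbhd (a s) r ≡ nbhd (c s) r
  a-c-twins s (z _) _    = refl
  a-c-twins s (y _) _    = refl
  a-c-twins s (a t) _    = trans (does-≟-sym _≟_ s t) (sym (∨-identityʳ _))
  a-c-twins s (b t) _    = cong (_∨ false) (trans (∨-identityʳ _) (does-≟-sym _≟_ s t))
  a-c-twins s (c t) _    = trans (∨-identityʳ _) (∨-identityʳ _)
  a-c-twins s (d t) r≢ds =
    trans (trans (∨-identityʳ _) (∨-identityʳ _)) (dec-false (s ≟ t) (r≢ds ∘ cong d ∘ sym))

  twins⇒I-≡ : ∀ {C} p q w → (∀ r → r ≢ w → nbhd p r ≡ nbhd q r) → index w ∉ C →
              I G C (index p) ≡ I G C (index q)
  twins⇒I-≡ p q w agree w∉C = N[]-agree⇒I-≡ G w∉C λ x x≢w →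
    trans (lookup-N[index] p x)
          (trans (agree (vertex x) (x≢w ∘ index-at x)) (sym (lookup-N[index] q x)))
    where
    index-at : ∀ x → vertex x ≡ w → x ≡ index w
    index-at x eq = trans (sym (index-vertex x)) (cong index eq)

  member : Subset n → Vertex → Bool
  member C p = lookup C (index p)

  member-at : ∀ {C x p} → x ∈ C → vertex x ≡ p → T (member C p)
  member-at {C} {x} x∈C refl = subst T (cong (lookup C) (sym (index-vertex x))) (∈⇒T x∈C)

  member-false⇒∉ : ∀ {C} p → member C p ≡ false → index p ∉ C
  member-false⇒∉ p eq = subst T eq ∘ ∈⇒T

  dominating-meets-z-y : ∀ {C} → Dominating G C → ∀ i → T (member C (z i) ∨ member C (y i))
  dominating-meets-z-y {C} dominating i
    with x , x∈C , x∈N ← dominating (index (y i))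
    with nbhd-y i (vertex x) (subst T (lookup-N[index] (y i) x) (∈⇒T x∈N))
  ... | inj₁ x≡z = Equivalence.from (T-∨ {member C (z i)}) (inj₁ (member-at x∈C x≡z))
  ... | inj₂ x≡y = Equivalence.from (T-∨ {member C (z i)}) (inj₂ (member-at x∈C x≡y))

  locating-meets-b-c-d : ∀ {C} → (∀ u v → u ∉ C → v ∉ C → u ≢ v → I G C u ≢ I G C v) →
                         ∀ s → T (member C (b s) ∨ (member C (c s) ∨ member C (d s)))
  locating-meets-b-c-d {C} locating s
    with member C (b s) in b∉ | member C (c s) in c∉ | member C (d s) in d∉
  ... | true  | _     | _    = _
  ... | false | true  | _    = _
  ... | false | false | true = _
  ... | false | false | false =
    locating (index (b s)) (index (d s)) (member-false⇒∉ (b s) b∉) (member-false⇒∉ (d s) d∉)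
      (index-≢ (b s) (d s) λ ())
      (twins⇒I-≡ (b s) (d s) (c s) (b-d-twins s) (member-false⇒∉ (c s) c∉))

  total-contains-z : ∀ {C} → TotalDominating G C → ∀ i → T (member C (z i))
  total-contains-z total i with x , x∈C , y∼x ← total (index (y i)) =
    member-at x∈C (∼-y i (vertex x) (subst T (cong (_∼ vertex x) (vertex-index (y i))) y∼x))

  total-meets-a-b : ∀ {C} → TotalDominating G C → ∀ s → T (member C (a s) ∨ member C (b s))
  total-meets-a-b {C} total s
    with x , x∈C , d∼x ← total (index (d s))
    with ∼-d s (vertex x) (subst T (cong (_∼ vertex x) (vertex-index (d s))) d∼x)
  ... | inj₁ x≡a = Equivalence.from (T-∨ {member C (a s)}) (inj₁ (member-at x∈C x≡a))
  ... | inj₂ x≡b = Equivalence.from (T-∨ {member C (a s)}) (inj₂ (member-at x∈C x≡b))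

  identifying-contains-c : ∀ {C} → (∀ u v → u ≢ v → I G C u ≢ I G C v) → ∀ s → T (member C (c s))
  identifying-contains-c {C} identifying s with member C (c s) in c∉
  ... | true  = _
  ... | false = identifying (index (b s)) (index (d s)) (index-≢ (b s) (d s) λ ())
                  (twins⇒I-≡ (b s) (d s) (c s) (b-d-twins s) (member-false⇒∉ (c s) c∉))

  identifying-contains-d : ∀ {C} → (∀ u v → u ≢ v → I G C u ≢ I G C v) → ∀ s → T (member C (d s))
  identifying-contains-d {C} identifying s with member C (d s) in d∉
  ... | true  = _
  ... | false = identifying (index (a s)) (index (c s)) (index-≢ (a s) (c s) λ ())
                  (twins⇒I-≡ (a s) (c s) (d s) (a-c-twins s) (member-false⇒∉ (d s) d∉))

  module Census (C : Subset n) where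

    #z #y #a #b #c #d : ℕ
    #z = count (member C ∘ z)
    #y = count (member C ∘ y)
    #a = count (member C ∘ a)
    #b = count (member C ∘ b)
    #c = count (member C ∘ c)
    #d = count (member C ∘ d)

    ∣C∣≡census : ∣ C ∣ ≡ #z + (#y + (#a + (#b + (#c + #d))))
    ∣C∣≡census = trans (∣∣≡count-lookup C)
      (trans (count-cong (cong (lookup C) ∘ sym ∘ index-vertex)) (count-vertex (member C)))

  ld-lower-bound : ∀ C → LocatingDominating G C → k + g ≤ ∣ C ∣
  ld-lower-bound C (dominating , locating) = begin
    k + g
      ≤⟨ +-mono-≤ (≤-count-∨ (member C ∘ z) (member C ∘ y) (dominating-meets-z-y dominating))
                  (≤-trans (≤-count-∨ (member C ∘ b) _ (locating-meets-b-c-d locating))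
                           (+-monoʳ-≤ #b (count-∨ (member C ∘ c) (member C ∘ d)))) ⟩
    (#z + #y) + (#b + (#c + #d))
      ≡⟨ +-assoc #z #y _ ⟩
    #z + (#y + (#b + (#c + #d)))
      ≤⟨ +-monoʳ-≤ #z (+-monoʳ-≤ #y (m≤n+m _ #a)) ⟩
    #z + (#y + (#a + (#b + (#c + #d))))
      ≡⟨ sym ∣C∣≡census ⟩
    ∣ C ∣ ∎
    where
    open ≤-Reasoning
    open Census C

  tdid-lower-bound : ∀ C → TotalDominatingIdentifyingCode G C → k + (g + (g + g)) ≤ ∣ C ∣
  tdid-lower-bound C (total , identifying) = begin
    k + (g + (g + g))
      ≡⟨ cong₂ (λ #z′ #cd → #z′ + (g + #cd)) (sym (count-true (total-contains-z total)))
           (cong₂ _+_ (sym (count-true (identifying-contains-c identifying)))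
                      (sym (count-true (identifying-contains-d identifying)))) ⟩
    #z + (g + (#c + #d))
      ≤⟨ +-monoʳ-≤ #z (+-monoˡ-≤ (#c + #d)
           (≤-count-∨ (member C ∘ a) (member C ∘ b) (total-meets-a-b total))) ⟩
    #z + ((#a + #b) + (#c + #d))
      ≡⟨ cong (#z +_) (+-assoc #a #b _) ⟩
    #z + (#a + (#b + (#c + #d)))
      ≤⟨ +-monoʳ-≤ #z (m≤n+m _ #y) ⟩
    #z + (#y + (#a + (#b + (#c + #d))))
      ≡⟨ sym ∣C∣≡census ⟩
    ∣ C ∣ ∎
    where
    open ≤-Reasoning
    open Census C

  γL≡k+g : γL≡ G (k + g)
  γL≡k+g = (code ld , ld-locating-dominating , ∣code-ld∣) , ld-lower-bound

  γtID≡k+3g : γtID≡ G (k + (g + (g + g)))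
  γtID≡k+3g = (code tdid , tdid-total-dominating-identifying , ∣code-tdid∣) , tdid-lower-bound

  identifiable : Identifiable G
  identifiable = TDID⇒identifiable G tdid-total-dominating-identifying

  step→ : ∀ p q {w} → T (edge p q) → Walk G (index q) w → Walk G (index p) w
  step→ p q e = step (subst T (sym (cong₂ _∼_ (vertex-index p) (vertex-index q))) (edge→∼ p q e))

  step← : ∀ p q {w} → T (edge q p) → Walk G (index q) w → Walk G (index p) w
  step← p q e = step (subst T (sym (cong₂ _∼_ (vertex-index p) (vertex-index q))) (edge←∼ p q e))

  walk-to-hub : ∀ p → Walk G (index p) (index (z z₀))
  walk-to-hub (z i) = let s , i∈s , z₀∈s = F-links i in
                      step→ (z i) (a s) (∈⇒T i∈s) (step← (a s) (z z₀) (∈⇒T z₀∈s) here)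
  walk-to-hub (y i) = step← (y i) (z i) (≟-refl i) (walk-to-hub (z i))
  walk-to-hub (a s) = let i , i∈s = some-element s in
                      step← (a s) (z i) (∈⇒T i∈s) (walk-to-hub (z i))
  walk-to-hub (b s) = step← (b s) (a s) (≟-refl s) (walk-to-hub (a s))
  walk-to-hub (c s) = step← (c s) (a s) (≟-refl s) (walk-to-hub (a s))
  walk-to-hub (d s) = step← (d s) (a s) (≟-refl s) (walk-to-hub (a s))

  connected : Connected G
  connected = connected-via G (index (z z₀)) λ u →
    subst (λ u → Walk G u (index (z z₀))) (index-vertex u) (walk-to-hub (vertex u))

-- Subsets of Fin k with at least one and at least two elements

Subset≥1 : ℕ → Set
Subset≥1 zero    = ⊥
Subset≥1 (suc k) = Subset≥1 k ⊎ (⊤ ⊎ Subset≥1 k)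

Subset≥2 : ℕ → Set
Subset≥2 zero    = ⊥
Subset≥2 (suc k) = Subset≥2 k ⊎ Subset≥1 k

⟦_⟧₁ : ∀ {k} → Subset≥1 k → Subset k
⟦_⟧₁ {suc k} (inj₁ t)        = outside ∷ ⟦ t ⟧₁
⟦_⟧₁ {suc k} (inj₂ (inj₁ _)) = inside ∷ ∅
⟦_⟧₁ {suc k} (inj₂ (inj₂ t)) = inside ∷ ⟦ t ⟧₁

⟦_⟧₂ : ∀ {k} → Subset≥2 k → Subset k
⟦_⟧₂ {suc k} (inj₁ s) = outside ∷ ⟦ s ⟧₂
⟦_⟧₂ {suc k} (inj₂ t) = inside ∷ ⟦ t ⟧₁

#≥1 : ℕ → ℕ
#≥1 zero    = 0
#≥1 (suc k) = #≥1 k + (1 + #≥1 k)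

#≥2 : ℕ → ℕ
#≥2 zero    = 0
#≥2 (suc k) = #≥2 k + #≥1 k

enum≥1 : ∀ k → Fin (#≥1 k) ↔ Subset≥1 k
enum≥1 zero    = 0↔⊥
enum≥1 (suc k) = enum≥1 k ⊕ 1↔⊤ ⊕ enum≥1 k

enum≥2 : ∀ k → Fin (#≥2 k) ↔ Subset≥2 k
enum≥2 zero    = 0↔⊥
enum≥2 (suc k) = enum≥2 k ⊕ enum≥1 k

⟦⟧₁-nonempty : ∀ {k} (t : Subset≥1 k) → ∃ λ i → i ∈ ⟦ t ⟧₁
⟦⟧₁-nonempty {suc k} (inj₁ t)        = let i , i∈t = ⟦⟧₁-nonempty t in suc i , there i∈t
⟦⟧₁-nonempty {suc k} (inj₂ (inj₁ _)) = zero , here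
⟦⟧₁-nonempty {suc k} (inj₂ (inj₂ _)) = zero , here

⟦⟧₂-nonempty : ∀ {k} (s : Subset≥2 k) → ∃ λ i → i ∈ ⟦ s ⟧₂
⟦⟧₂-nonempty {suc k} (inj₁ s) = let i , i∈s = ⟦⟧₂-nonempty s in suc i , there i∈s
⟦⟧₂-nonempty {suc k} (inj₂ _) = zero , here

⟦⟧₂-large : ∀ {k} (s : Subset≥2 k) i → ∃ λ j → j ≢ i × j ∈ ⟦ s ⟧₂
⟦⟧₂-large {suc k} (inj₁ s) zero    = let j , j∈s = ⟦⟧₂-nonempty s in suc j , (λ ()) , there j∈s
⟦⟧₂-large {suc k} (inj₁ s) (suc i) =
  let j , j≢i , j∈s = ⟦⟧₂-large s i in suc j , j≢i ∘ suc-injective , there j∈s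
⟦⟧₂-large {suc k} (inj₂ t) zero    = let j , j∈t = ⟦⟧₁-nonempty t in suc j , (λ ()) , there j∈t
⟦⟧₂-large {suc k} (inj₂ t) (suc i) = zero , (λ ()) , here

⟦⟧₁-injective : ∀ {k} → Injective _≡_ _≡_ (⟦_⟧₁ {k})
⟦⟧₁-injective {suc k} {inj₁ t}        {inj₁ t′}        eq =
  cong inj₁ (⟦⟧₁-injective (∷-injectiveʳ eq))
⟦⟧₁-injective {suc k} {inj₂ (inj₁ _)} {inj₂ (inj₁ _)} _  = refl
⟦⟧₁-injective {suc k} {inj₂ (inj₂ t)} {inj₂ (inj₂ t′)} eq =
  cong (inj₂ ∘ inj₂) (⟦⟧₁-injective (∷-injectiveʳ eq))
⟦⟧₁-injective {suc k} {inj₂ (inj₁ _)} {inj₂ (inj₂ t′)} eq =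
  let i , i∈t′ = ⟦⟧₁-nonempty t′ in ⊥-elim (∉⊥ (subst (i ∈_) (sym (∷-injectiveʳ eq)) i∈t′))
⟦⟧₁-injective {suc k} {inj₂ (inj₂ t)} {inj₂ (inj₁ _)} eq =
  let i , i∈t = ⟦⟧₁-nonempty t in ⊥-elim (∉⊥ (subst (i ∈_) (∷-injectiveʳ eq) i∈t))
⟦⟧₁-injective {suc k} {inj₁ _} {inj₂ (inj₁ _)} ()
⟦⟧₁-injective {suc k} {inj₁ _} {inj₂ (inj₂ _)} ()
⟦⟧₁-injective {suc k} {inj₂ (inj₁ _)} {inj₁ _} ()
⟦⟧₁-injective {suc k} {inj₂ (inj₂ _)} {inj₁ _} ()

⟦⟧₂-injective : ∀ {k} → Injective _≡_ _≡_ (⟦_⟧₂ {k})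
⟦⟧₂-injective {suc k} {inj₁ s} {inj₁ s′} eq = cong inj₁ (⟦⟧₂-injective (∷-injectiveʳ eq))
⟦⟧₂-injective {suc k} {inj₂ t} {inj₂ t′} eq = cong inj₂ (⟦⟧₁-injective (∷-injectiveʳ eq))
⟦⟧₂-injective {suc k} {inj₁ _} {inj₂ _} ()
⟦⟧₂-injective {suc k} {inj₂ _} {inj₁ _} ()

singleton : ∀ {k} (i : Fin k) → ∃ λ t → i ∈ ⟦ t ⟧₁
singleton zero    = inj₂ (inj₁ _) , here
singleton (suc i) = let t , i∈t = singleton i in inj₁ t , there i∈t

⟦⟧₂-links : ∀ {m} (i : Fin (suc (suc m))) → ∃ λ s → i ∈ ⟦ s ⟧₂ × zero ∈ ⟦ s ⟧₂
⟦⟧₂-links zero    = let t , _ = singleton zero in inj₂ t , here , here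
⟦⟧₂-links (suc i) = let t , i∈t = singleton i in inj₂ t , there i∈t , here

#≥1+1≡2^k : ∀ k → #≥1 k + 1 ≡ 2 ^ k
#≥1+1≡2^k zero    = refl
#≥1+1≡2^k (suc k) =
  trans (shuffle (#≥1 k)) (cong₂ (λ p q → p + (q + 0)) (#≥1+1≡2^k k) (#≥1+1≡2^k k))
  where
  shuffle : ∀ x → x + (1 + x) + 1 ≡ (x + 1) + ((x + 1) + 0)
  shuffle = solve-∀

k+#≥2+1≡2^k : ∀ k → k + #≥2 k + 1 ≡ 2 ^ k
k+#≥2+1≡2^k zero    = refl
k+#≥2+1≡2^k (suc k) =
  trans (shuffle k (#≥2 k) (#≥1 k)) (cong₂ (λ p q → p + (q + 0)) (k+#≥2+1≡2^k k) (#≥1+1≡2^k k))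
  where
  shuffle : ∀ k g x → suc k + (g + x) + 1 ≡ (k + g + 1) + ((x + 1) + 0)
  shuffle = solve-∀

module _ (k g : ℕ) (k+g+1≡2^k : k + g + 1 ≡ 2 ^ k) where

  2^k∸1≡k+g : 2 ^ k ∸ 1 ≡ k + g
  2^k∸1≡k+g = trans (cong (_∸ 1) (sym k+g+1≡2^k)) (m+n∸n≡m (k + g) 1)

  3*2^k∸2k∸3≡k+3g : 3 * 2 ^ k ∸ 2 * k ∸ 3 ≡ k + (g + (g + g))
  3*2^k∸2k∸3≡k+3g = begin
    3 * 2 ^ k ∸ 2 * k ∸ 3
      ≡⟨ cong (λ p → 3 * p ∸ 2 * k ∸ 3) (sym k+g+1≡2^k) ⟩
    3 * (k + g + 1) ∸ 2 * k ∸ 3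
      ≡⟨ cong (λ p → p ∸ 2 * k ∸ 3) (expand k g) ⟩
    k + (g + (g + g)) + 3 + 2 * k ∸ 2 * k ∸ 3
      ≡⟨ cong (_∸ 3) (m+n∸n≡m (k + (g + (g + g)) + 3) (2 * k)) ⟩
    k + (g + (g + g)) + 3 ∸ 3
      ≡⟨ m+n∸n≡m _ 3 ⟩
    k + (g + (g + g)) ∎
    where
    open ≡-Reasoning
    expand : ∀ k g → 3 * (k + g + 1) ≡ k + (g + (g + g)) + 3 + 2 * k
    expand = solve-∀

  3[2^k∸1]∸2log≡k+3g : 3 * (2 ^ k ∸ 1) ∸ 2 * ⌊log₂ (2 ^ k ∸ 1 + 1) ⌋ ≡ k + (g + (g + g))
  3[2^k∸1]∸2log≡k+3g = begin
    3 * (2 ^ k ∸ 1) ∸ 2 * ⌊log₂ (2 ^ k ∸ 1 + 1) ⌋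
      ≡⟨ cong₂ (λ p q → 3 * p ∸ 2 * q) 2^k∸1≡k+g log≡k ⟩
    3 * (k + g) ∸ 2 * k
      ≡⟨ cong (_∸ 2 * k) (expand k g) ⟩
    k + (g + (g + g)) + 2 * k ∸ 2 * k
      ≡⟨ m+n∸n≡m _ (2 * k) ⟩
    k + (g + (g + g)) ∎
    where
    open ≡-Reasoning
    expand : ∀ k g → 3 * (k + g) ≡ k + (g + (g + g)) + 2 * k
    expand = solve-∀
    log≡k : ⌊log₂ (2 ^ k ∸ 1 + 1) ⌋ ≡ k
    log≡k = trans (cong (λ p → ⌊log₂ (p + 1) ⌋) 2^k∸1≡k+g)
                  (trans (cong ⌊log₂_⌋ k+g+1≡2^k) (⌊log₂[2^n]⌋≡n k))

proposition21 : (k : ℕ) → 2 ≤ k →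
    Σ ℕ λ n → Σ (Graph n) λ G →
      Connected G × Identifiable G
      × γL≡ G (2 ^ k ∸ 1)
      × γtID≡ G (3 * 2 ^ k ∸ 2 * k ∸ 3)
      × (3 * 2 ^ k ∸ 2 * k ∸ 3 ≡ 3 * (2 ^ k ∸ 1) ∸ 2 * ⌊log₂ (2 ^ k ∸ 1 + 1) ⌋)
proposition21 k@(suc (suc _)) (s≤s (s≤s _)) =
  n , G , connected , identifiable ,
  subst (γL≡ G) (sym (2^k∸1≡k+g k g size)) γL≡k+g ,
  subst (γtID≡ G) (sym (3*2^k∸2k∸3≡k+3g k g size)) γtID≡k+3g ,
  trans (3*2^k∸2k∸3≡k+3g k g size) (sym (3[2^k∸1]∸2log≡k+3g k g size))
  where
  g    = #≥2 k
  size = k+#≥2+1≡2^k k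
  open Inverse (enum≥2 k) using (to; from; strictlyInverseˡ)
  F : Fin g → Subset k
  F = ⟦_⟧₂ ∘ to
  F-links : ∀ i → ∃ λ s → i ∈ F s × zero ∈ F s
  F-links i = let s , i∈s , 0∈s = ⟦⟧₂-links i
                  F[from-s]≡s   = cong ⟦_⟧₂ (sym (strictlyInverseˡ s))
              in  from s , subst (i ∈_) F[from-s]≡s i∈s , subst (zero ∈_) F[from-s]≡s 0∈s
  open Construction k g F (Injection.injective (Inverse⇒Injection (enum≥2 k)) ∘ ⟦⟧₂-injective)
                         (⟦⟧₂-large ∘ to) zero F-links
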